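{- Let $n$ be a positive integer, $m=\lfloor n/2\rfloor$, and let $S\subseteq[0,n]$ be a $B_3$-sequence of size $r$. Put $S_1=S\cap[0,m]$, $S_2=S\cap(m,n]$, $\bar S_2=\{n-x:x\in S_2\}$. For $x\in[0,n]$ let $\bar x=x$ if $x\le m$ and $\bar x=n-x$ if $x>m$, and let $z_1\le z_2\le\dots\le z_r\,(\le m)$ be the values $\bar x$, $x\in S$, listed in nondecreasing order (with multiplicity). For a set of integers $F$ and a positive integer $q$ let $$\Delta_q(F)=\{(x,y): x,y\in F,\ q<x,\ 0<y-x\le q\}.$$ Suppose $q$ is a positive integer and $i$ is an index with $1\le i\le r-1$ such that $z_i\le q<z_{i+1}$. Then $$\frac{(r-i)\bigl(q(r-i)/n-1\bigr)}{2}\le\bigl|\Delta_q(S_1)\cup\Delta_q(\bar S_2)\bigr|.$$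
   Context: A finite set $S$ of non-negative integers is a $B_3$-sequence if all sums of three of its elements (repetitions allowed) are different, i.e. whenever $x_1+x_2+x_3=y_1+y_2+y_3$ with all $x_i,y_i\in S$, the multisets $\{x_1,x_2,x_3\}$ and $\{y_1,y_2,y_3\}$ coincide. -}

module Defs where

open import Data.Nat using (ℕ; zero; suc; _+_; _*_; _∸_; _≤_; _<_; _≤?_; _<?_; _≟_)
open import Data.Nat.DivMod using (_/_)
open import Data.Nat.Properties using (≤-decTotalOrder)
open import Data.Bool using (if_then_else_)
open import Data.Maybe using (Maybe; just; nothing)
open import Data.Product using (_×_; _,_)
open import Data.Product.Properties using (≡-dec)
open import Data.List using (List; []; _∷_; map; filter; concatMap; deduplicate; length; _++_)
open import Data.List.Membership.Propositional using (_∈_)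
open import Data.List.Relation.Binary.Permutation.Propositional using (_↭_)
open import Relation.Nullary.Decidable using (does; _×-dec_)
open import Relation.Binary.PropositionalEquality using (_≡_)
import Data.List.Sort.MergeSort as MS

half : ℕ → ℕ
half n = n / 2

-- B_3 property of a finite set S (given as a duplicate-free list)
IsB3 : List ℕ → Set
IsB3 S = ∀ {x₁ x₂ x₃ y₁ y₂ y₃} →
  x₁ ∈ S → x₂ ∈ S → x₃ ∈ S → y₁ ∈ S → y₂ ∈ S → y₃ ∈ S →
  x₁ + x₂ + x₃ ≡ y₁ + y₂ + y₃ →
  (x₁ ∷ x₂ ∷ x₃ ∷ []) ↭ (y₁ ∷ y₂ ∷ y₃ ∷ [])

S₁ : ℕ → List ℕ → List ℕ
S₁ n S = filter (λ x → x ≤? half n) S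

S̄₂ : ℕ → List ℕ → List ℕ
S̄₂ n S = map (λ x → n ∸ x) (filter (λ x → half n <? x) S)

bar : ℕ → ℕ → ℕ
bar n x = if does (x ≤? half n) then x else n ∸ x

-- z₁ ≤ … ≤ z_r, stored 0-indexed: z_i = nth (zs n S) (i ∸ 1)
zs : ℕ → List ℕ → List ℕ
zs n S = MS.sort ≤-decTotalOrder (map (bar n) S)

nth : List ℕ → ℕ → Maybe ℕ
nth [] _ = nothing
nth (x ∷ xs) zero = just x
nth (x ∷ xs) (suc k) = nth xs k

-- Δ_q(F) = {(x,y) : x,y ∈ F, q < x, 0 < y - x ≤ q}, as a list
-- (duplicate-free when F is)
Δ : ℕ → List ℕ → List (ℕ × ℕ)
Δ q F = concatMap (λ x → map (λ y → (x , y))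
          (filter (λ y → (x <? y) ×-dec (y ≤? x + q)) F))
        (filter (λ x → q <? x) F)

cardΔ∪ : ℕ → ℕ → List ℕ → ℕ
cardΔ∪ n q S = length (deduplicate (≡-dec _≟_ _≟_) (Δ q (S₁ n S) ++ Δ q (S̄₂ n S)))

-- Fold [0,n] in half: the values x̄ all lie in [0,m], and those exceeding q come from
-- T₁ = S₁ ∩ (q,m] and T₂ = S̄₂ ∩ (q,m]; since z_{i+1} > q there are at least r − i of them.
-- Cut (q, q + ⌊m/q⌋q] ⊇ (q,m] into K = ⌊m/q⌋ windows of length q.  A window holding s points
-- of a set contributes s(s−1)/2 pairs to Δ_q, so Cauchy–Schwarz over the windows gives
-- |T|² ≤ K(2|Δ_q| + |T|) for each of T₁, T₂, and once more for their union.  The B₃ property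
-- makes Δ_q(S₁) and Δ_q(S̄₂) disjoint: a common pair (x, y) = (n − u, n − v) gives
-- x + u = y + v, which forces v ∈ {x, u}.  Finally 2Kq ≤ 2m ≤ n.
module Submission where

open import Defs
open import Data.Nat using (ℕ; _≤_; _<_; _∸_)
open import Data.Integer using (ℤ; +_) renaming (_*_ to _*ℤ_; _-_ to _-ℤ_; _≤_ to _≤ℤ_)
open import Data.Maybe using (just)
open import Data.List using (List; length)
open import Data.List.Relation.Unary.All using (All)
open import Data.List.Relation.Unary.Unique.Propositional using (Unique)
open import Relation.Binary.PropositionalEquality using (_≡_)

open import Data.Bool using (true; false; if_then_else_)
open import Data.Empty using (⊥; ⊥-elim)
open import Data.Integer using (-_; +≤+)
import Data.Integer.Properties as ℤP
open ℤP using (pos-*)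
open import Data.List using ([]; _∷_; _++_; map; filter; concatMap; deduplicate)
open import Data.List.Membership.Propositional using (_∈_)
open import Data.List.Membership.Propositional.Properties using (∈-map⁻; ∈-filter⁻; ∈-++⁻)
open import Data.List.Properties using (map-++; length-++; length-map; filter-accept; filter-reject; filter-all; filter-++; partition-defn)
open import Data.List.Relation.Binary.Disjoint.Propositional using (Disjoint)
open import Data.List.Relation.Binary.Permutation.Propositional using (_↭_; ↭-refl; ↭-prep; ↭-sym; ↭-trans; ↭ₛ⇒↭; module PermutationReasoning)
open import Data.List.Relation.Binary.Permutation.Propositional.Properties using (↭-length; filter-↭; ∈-resp-↭; shift) renaming (map⁺ to ↭-map⁺)
open import Data.List.Relation.Binary.Sublist.Propositional using (_⊆_; ⊆-refl; _∷ʳ_)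
open import Data.List.Relation.Binary.Sublist.Propositional.Properties using (filter-⊆; length-mono-≤) renaming (filter⁺ to ⊆-filter⁺)
open import Data.List.Relation.Unary.All using ([]; _∷_; zipWith)
import Data.List.Relation.Unary.All as All
open import Data.List.Relation.Unary.All.Properties using (all-filter) renaming (filter⁺ to All-filter⁺; map⁺ to All-map⁺)
open import Data.List.Relation.Unary.AllPairs using ([]; _∷_)
open import Data.List.Relation.Unary.Any using (here; there)
open import Data.List.Relation.Unary.Linked using (Linked) renaming (tail to Linked-tail)
open import Data.List.Relation.Unary.Linked.Properties using (Linked⇒All)
import Data.List.Relation.Unary.Unique.Propositional.Properties as Unique
open import Data.Nat using (zero; suc; _+_; _*_; _/_; _%_; z≤n; s≤s⁻¹; _<?_; _≤?_; _≟_; NonZero; >-nonZero)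
open import Data.Nat.DivMod using (m≡m%n+[m/n]*n; m%n<n; m/n*n≤m)
open import Data.Nat.ListAction using (sum)
open import Data.Nat.ListAction.Properties using (sum-++; sum-↭)
open import Data.Nat.Properties
open import Algebra.Properties.CommutativeSemigroup +-commutativeSemigroup using (interchange)
open import Data.List.Sort.MergeSort.Properties ≤-decTotalOrder using (sort-↭; sort-↗)
open import Data.Nat.Tactic.RingSolver using (solve-∀)
open import Data.Product using (∃; _×_; _,_; proj₁; proj₂)
open import Data.Product.Properties using (≡-dec)
open import Data.Sum using (_⊎_; inj₁; inj₂; [_,_])
open import Function using (_∘_)
open import Level using (0ℓ)
open import Relation.Binary.Definitions using (Decidable; DecidableEquality; tri<; tri≈; tri>)
open import Relation.Binary.PropositionalEquality using (_≢_; refl; sym; trans; cong; cong₂; subst; setoid; module ≡-Reasoning)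
open import Relation.Nullary.Decidable using (yes; no; does; _×-dec_; dec-true; dec-false)
open import Relation.Nullary.Negation using (¬_; contradiction)
open import Relation.Unary using (Pred) renaming (Decidable to Decidable₁)
open import Relation.Unary.Properties using (∁?)

2*m*n≤m*m+n*n : ∀ m n → 2 * (m * n) ≤ m * m + n * n
2*m*n≤m*m+n*n zero    n = z≤n
2*m*n≤m*m+n*n (suc m) zero rewrite *-zeroʳ m = z≤n
2*m*n≤m*m+n*n (suc m) (suc n) = begin
  2 * (suc m * suc n)              ≡⟨ expandˡ m n ⟩
  2 * (m * n) + 2 * (1 + m + n)    ≤⟨ +-monoˡ-≤ _ (2*m*n≤m*m+n*n m n) ⟩
  m * m + n * n + 2 * (1 + m + n)  ≡⟨ expandʳ m n ⟩
  suc m * suc m + suc n * suc n    ∎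
  where
  open ≤-Reasoning
  expandˡ : ∀ m n → 2 * (suc m * suc n) ≡ 2 * (m * n) + 2 * (1 + m + n)
  expandˡ = solve-∀
  expandʳ : ∀ m n → m * m + n * n + 2 * (1 + m + n) ≡ suc m * suc m + suc n * suc n
  expandʳ = solve-∀

cauchy-schwarz₂ : ∀ a b k l A B → a * a ≤ k * A → b * b ≤ l * B →
                  (a + b) * (a + b) ≤ (k + l) * (A + B)
cauchy-schwarz₂ zero    b zero l A B _  b²≤ = ≤-trans b²≤ (*-monoʳ-≤ l (m≤n+m B A))
cauchy-schwarz₂ (suc a) b zero l A B () _
cauchy-schwarz₂ a zero    (suc k) zero A B a²≤ _ rewrite +-identityʳ a | +-identityʳ k =
  ≤-trans a²≤ (*-monoʳ-≤ (suc k) (m≤m+n A B))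
cauchy-schwarz₂ a (suc b) (suc k) zero A B _ ()
cauchy-schwarz₂ a b k@(suc _) l@(suc _) A B a²≤ b²≤ = *-cancelˡ-≤ (k * l) (begin
  (k * l) * ((a + b) * (a + b))
    ≡⟨ expand a b k l ⟩
  k * l * (a * a) + k * l * (b * b) + 2 * ((l * a) * (k * b))
    ≤⟨ +-monoʳ-≤ (k * l * (a * a) + k * l * (b * b)) (2*m*n≤m*m+n*n (l * a) (k * b)) ⟩
  k * l * (a * a) + k * l * (b * b) + ((l * a) * (l * a) + (k * b) * (k * b))
    ≡⟨ regroup a b k l ⟩
  (k + l) * (l * (a * a) + k * (b * b))
    ≤⟨ *-monoʳ-≤ (k + l) (+-mono-≤ (*-monoʳ-≤ l a²≤) (*-monoʳ-≤ k b²≤)) ⟩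
  (k + l) * (l * (k * A) + k * (l * B))
    ≡⟨ factor A B k l ⟩
  (k * l) * ((k + l) * (A + B)) ∎)
  where
  open ≤-Reasoning
  expand : ∀ a b k l → (k * l) * ((a + b) * (a + b)) ≡
                       k * l * (a * a) + k * l * (b * b) + 2 * ((l * a) * (k * b))
  expand = solve-∀
  regroup : ∀ a b k l → k * l * (a * a) + k * l * (b * b) + ((l * a) * (l * a) + (k * b) * (k * b)) ≡
                        (k + l) * (l * (a * a) + k * (b * b))
  regroup = solve-∀
  factor : ∀ A B k l → (k + l) * (l * (k * A) + k * (l * B)) ≡ (k * l) * ((k + l) * (A + B))
  factor = solve-∀

2*a+c+[2*b+d]≡2*[a+b]+[c+d] : ∀ a b c d → 2 * a + c + (2 * b + d) ≡ 2 * (a + b) + (c + d)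
2*a+c+[2*b+d]≡2*[a+b]+[c+d] = solve-∀

m*2≡m+m : ∀ m → m * 2 ≡ m + m
m*2≡m+m = solve-∀

+t*[+a-+b]≤+[t*[a∸b]] : ∀ t a b → + t *ℤ (+ a -ℤ + b) ≤ℤ + (t * (a ∸ b))
+t*[+a-+b]≤+[t*[a∸b]] t a b with b ≤? a
... | yes b≤a = ℤP.≤-reflexive (begin
  + t *ℤ (+ a -ℤ + b)  ≡⟨ cong (+ t *ℤ_) (trans (ℤP.m-n≡m⊖n a b) (ℤP.⊖-≥ b≤a)) ⟩
  + t *ℤ + (a ∸ b)     ≡⟨ pos-* t (a ∸ b) ⟨
  + (t * (a ∸ b))      ∎)
  where open ≡-Reasoning
... | no b≰a = ℤP.≤-trans (ℤP.≤-reflexive (begin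
  + t *ℤ (+ a -ℤ + b)      ≡⟨ cong (+ t *ℤ_) (trans (ℤP.m-n≡m⊖n a b) (ℤP.⊖-< (≰⇒> b≰a))) ⟩
  + t *ℤ - + (b ∸ a)     ≡⟨ ℤP.neg-distribʳ-* (+ t) (+ (b ∸ a)) ⟨
  - (+ t *ℤ + (b ∸ a))   ≡⟨ cong -_ (pos-* t (b ∸ a)) ⟨
  - + (t * (b ∸ a))      ∎)) ℤP.neg-≤-pos
  where open ≡-Reasoning

t*[q*t∸n]≤2*n*c : ∀ {n q t u c k} → t ≤ u → k * q ≤ n → u * u ≤ k * (2 * c + u) →
                   t * (q * t ∸ n) ≤ 2 * n * c
t*[q*t∸n]≤2*n*c {n} {q} {t} {u} {c} {k} t≤u kq≤n u²≤ = begin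
  t * (q * t ∸ n)      ≤⟨ *-mono-≤ t≤u (∸-monoˡ-≤ n (*-monoʳ-≤ q t≤u)) ⟩
  u * (q * u ∸ n)      ≡⟨ *-distribˡ-∸ u (q * u) n ⟩
  u * (q * u) ∸ u * n  ≤⟨ m≤n+o⇒m∸n≤o (u * (q * u)) (u * n) u²q≤ ⟩
  2 * n * c            ∎
  where
  open ≤-Reasoning
  commute : ∀ u q → u * (q * u) ≡ u * u * q
  commute = solve-∀
  commute′ : ∀ k x q → k * x * q ≡ k * q * x
  commute′ = solve-∀
  distrib : ∀ n c u → n * (2 * c + u) ≡ u * n + 2 * n * c
  distrib = solve-∀
  u²q≤ : u * (q * u) ≤ u * n + 2 * n * c
  u²q≤ = begin
    u * (q * u)          ≡⟨ commute u q ⟩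
    u * u * q            ≤⟨ *-monoˡ-≤ q u²≤ ⟩
    k * (2 * c + u) * q  ≡⟨ commute′ k (2 * c + u) q ⟩
    k * q * (2 * c + u)  ≤⟨ *-monoˡ-≤ (2 * c + u) kq≤n ⟩
    n * (2 * c + u)      ≡⟨ distrib n c u ⟩
    u * n + 2 * n * c    ∎

counting-bound⇒ℤ : ∀ {n q t u c} k → t ≤ u → k * q ≤ n → u * u ≤ k * (2 * c + u) →
                   + t *ℤ (+ q *ℤ + t -ℤ + n) ≤ℤ + 2 *ℤ + n *ℤ + c
counting-bound⇒ℤ {n} {q} {t} {u} {c} k t≤u kq≤n u²≤ = begin
  + t *ℤ (+ q *ℤ + t -ℤ + n)  ≡⟨ cong (λ z → + t *ℤ (z -ℤ + n)) (pos-* q t) ⟨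
  + t *ℤ (+ (q * t) -ℤ + n)   ≤⟨ +t*[+a-+b]≤+[t*[a∸b]] t (q * t) n ⟩
  + (t * (q * t ∸ n))         ≤⟨ +≤+ (t*[q*t∸n]≤2*n*c {n} {q} {t} {u} {c} {k} t≤u kq≤n u²≤) ⟩
  + (2 * n * c)               ≡⟨ trans (pos-* (2 * n) c) (cong (_*ℤ + c) (pos-* 2 n)) ⟩
  + 2 *ℤ + n *ℤ + c           ∎
  where open ℤP.≤-Reasoning

module _ {A : Set} where

  open import Data.List.Relation.Binary.Permutation.Setoid.Properties (setoid A) using (partition-↭)

  length-filter-∷ : ∀ {P : Pred A 0ℓ} (P? : Decidable₁ P) x xs →
                    length (filter P? (x ∷ xs)) ≡ (if does (P? x) then 1 else 0) + length (filter P? xs)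
  length-filter-∷ P? x xs with does (P? x)
  ... | true  = refl
  ... | false = refl

  length-filter-+-filter : ∀ {P Q : Pred A 0ℓ} (P? : Decidable₁ P) (Q? : Decidable₁ Q) →
                           (∀ {y} → P y → Q y → ⊥) → ∀ {xs} → All (λ y → P y ⊎ Q y) xs →
                           length (filter P? xs) + length (filter Q? xs) ≡ length xs
  length-filter-+-filter P? Q? P∩Q=∅ [] = refl
  length-filter-+-filter P? Q? P∩Q=∅ {y ∷ xs} (P∪Qy ∷ P∪Q)
    rewrite length-filter-∷ P? y xs | length-filter-∷ Q? y xs
    with P? y | Q? y | length-filter-+-filter P? Q? P∩Q=∅ P∪Q
  ... | yes Py | yes Qy | _  = ⊥-elim (P∩Q=∅ Py Qy)
  ... | yes _  | no _   | ih = cong suc ih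
  ... | no _   | yes _  | ih = trans (+-suc _ _) (cong suc ih)
  ... | no ¬Py | no ¬Qy | _  = ⊥-elim ([ ¬Py , ¬Qy ] P∪Qy)

  ↭-filter-∁ : ∀ {P : Pred A 0ℓ} (P? : Decidable₁ P) xs → xs ↭ filter P? xs ++ filter (∁? P?) xs
  ↭-filter-∁ P? xs = subst (λ (ys , zs) → xs ↭ ys ++ zs) (partition-defn P? xs) (↭ₛ⇒↭ (partition-↭ P? xs))

  deduplicate-Unique : (_≟_ : DecidableEquality A) → ∀ {xs} → Unique xs → deduplicate _≟_ xs ≡ xs
  deduplicate-Unique _≟_ []           = refl
  deduplicate-Unique _≟_ (x∉xs ∷ !xs) =
    cong (_ ∷_) (trans (cong (filter _) (deduplicate-Unique _≟_ !xs)) (filter-all _ x∉xs))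

module _ {A : Set} {R : A → A → Set} (R? : Decidable R) where

  pairCount : List A → List A → ℕ
  pairCount T F = sum (map (λ x → length (filter (R? x) F)) T)

  relatedPairs : List A → List A → List (A × A)
  relatedPairs T F = concatMap (λ x → map (x ,_) (filter (R? x) F)) T

  length-relatedPairs : ∀ T F → length (relatedPairs T F) ≡ pairCount T F
  length-relatedPairs []      F = refl
  length-relatedPairs (x ∷ T) F = trans (length-++ (map (x ,_) (filter (R? x) F)))
    (cong₂ _+_ (length-map (x ,_) (filter (R? x) F)) (length-relatedPairs T F))

  ∈-relatedPairs⁻ : ∀ {x y} T F → (x , y) ∈ relatedPairs T F → x ∈ T × y ∈ F × R x y
  ∈-relatedPairs⁻ (z ∷ T) F p∈ with ∈-++⁻ (map (z ,_) (filter (R? z) F)) p∈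
  ... | inj₂ p∈′ = let (x∈T , rest) = ∈-relatedPairs⁻ T F p∈′ in there x∈T , rest
  ... | inj₁ p∈′ with ∈-map⁻ (z ,_) p∈′
  ...   | y , y∈ , refl = here refl , ∈-filter⁻ (R? z) y∈

  relatedPairs-Unique : ∀ {T F} → Unique T → Unique F → Unique (relatedPairs T F)
  relatedPairs-Unique []                 !F = []
  relatedPairs-Unique {x ∷ T} {F} (x∉T ∷ !T) !F =
    Unique.++⁺ (Unique.map⁺ (cong proj₂) (Unique.filter⁺ (R? x) !F)) (relatedPairs-Unique !T !F) disjoint
    where
    disjoint : Disjoint (map (x ,_) (filter (R? x) F)) (relatedPairs T F)
    disjoint (p∈x , p∈T) with ∈-map⁻ (x ,_) p∈x
    ... | _ , _ , refl = All.lookup x∉T (proj₁ (∈-relatedPairs⁻ T F p∈T)) refl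

  pairCount-++ˡ : ∀ xs ys F → pairCount (xs ++ ys) F ≡ pairCount xs F + pairCount ys F
  pairCount-++ˡ xs ys F = trans (cong sum (map-++ count xs ys)) (sum-++ (map count xs) (map count ys))
    where
    count : A → ℕ
    count x = length (filter (R? x) F)

  pairCount-↭ˡ : ∀ {T T′} F → T ↭ T′ → pairCount T F ≡ pairCount T′ F
  pairCount-↭ˡ F T↭T′ = sum-↭ (↭-map⁺ _ T↭T′)

  pairCount-monoʳ : ∀ T {F F′} → F ⊆ F′ → pairCount T F ≤ pairCount T F′
  pairCount-monoʳ []      F⊆F′ = z≤n
  pairCount-monoʳ (x ∷ T) F⊆F′ =
    +-mono-≤ (length-mono-≤ (⊆-filter⁺ (R? x) (R? x) (subst (R x)) F⊆F′)) (pairCount-monoʳ T F⊆F′)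

  pairCount-∷ʳ : ∀ T x F → pairCount T (x ∷ F) ≡ length (filter (λ z → R? z x) T) + pairCount T F
  pairCount-∷ʳ []      x F = refl
  pairCount-∷ʳ (z ∷ T) x F = begin
    length (filter (R? z) (x ∷ F)) + pairCount T (x ∷ F)
      ≡⟨ cong₂ _+_ (length-filter-∷ (R? z) x F) (pairCount-∷ʳ T x F) ⟩
    (Rzx + length (filter (R? z) F)) + (length (filter (λ w → R? w x) T) + pairCount T F)
      ≡⟨ interchange Rzx _ _ _ ⟩
    (Rzx + length (filter (λ w → R? w x) T)) + (length (filter (R? z) F) + pairCount T F)
      ≡⟨ cong (_+ _) (length-filter-∷ (λ w → R? w x) z T) ⟨
    length (filter (λ w → R? w x) (z ∷ T)) + pairCount (z ∷ T) F ∎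
    where
    open ≡-Reasoning
    Rzx = if does (R? z x) then 1 else 0

  pairCount-filter-∁ : ∀ {P : Pred A 0ℓ} (P? : Decidable₁ P) T →
    let lo = filter P? T ; hi = filter (∁? P?) T in
    pairCount lo lo + pairCount hi hi ≤ pairCount T T
  pairCount-filter-∁ P? T = begin
    pairCount lo lo + pairCount hi hi  ≤⟨ +-mono-≤ (pairCount-monoʳ lo (filter-⊆ P? T)) (pairCount-monoʳ hi (filter-⊆ (∁? P?) T)) ⟩
    pairCount lo T + pairCount hi T    ≡⟨ pairCount-++ˡ lo hi T ⟨
    pairCount (lo ++ hi) T             ≡⟨ pairCount-↭ˡ T (↭-filter-∁ P? T) ⟨
    pairCount T T                      ∎
    where
    open ≤-Reasoning
    lo = filter P? T
    hi = filter (∁? P?) T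

-- With this decision procedure, Δ q F unfolds to relatedPairs (window? q) (filter (q <?_) F) F.
Window : ℕ → ℕ → ℕ → Set
Window q x y = x < y × y ≤ x + q

window? : ∀ q → Decidable (Window q)
window? q x y = (x <? y) ×-dec (y ≤? x + q)

Between : ℕ → ℕ → ℕ → Set
Between l h x = l < x × x ≤ h

-- Inside a window of length q, every pair x < y is q-close: the count is |B| choose 2.
pairCount-window-Between : ∀ {q b} B → Unique B → All (Between b (b + q)) B →
  2 * pairCount (window? q) B B + length B ≡ length B * length B
pairCount-window-Between           []      _          _ = refl
pairCount-window-Between {q} {b} (x ∷ B) (x∉B ∷ !B) (bx ∷ bB) = begin
  2 * pairCount W (x ∷ B) (x ∷ B) + suc ℓ  ≡⟨ cong (λ d → 2 * d + suc ℓ) cons ⟩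
  2 * (ℓ + D) + suc ℓ                     ≡⟨ regroup ℓ D ⟩
  (2 * D + ℓ) + (1 + 2 * ℓ)               ≡⟨ cong (_+ (1 + 2 * ℓ)) (pairCount-window-Between B !B bB) ⟩
  ℓ * ℓ + (1 + 2 * ℓ)                     ≡⟨ square-suc ℓ ⟩
  suc ℓ * suc ℓ                           ∎
  where
  open ≡-Reasoning
  regroup : ∀ ℓ D → 2 * (ℓ + D) + suc ℓ ≡ (2 * D + ℓ) + (1 + 2 * ℓ)
  regroup = solve-∀
  square-suc : ∀ ℓ → ℓ * ℓ + (1 + 2 * ℓ) ≡ suc ℓ * suc ℓ
  square-suc = solve-∀
  W = window? q
  ℓ = length B
  D = pairCount W B B
  close : ∀ {y} → Between b (b + q) y → x ≢ y → Window q x y ⊎ Window q y x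
  close {y} (b<y , y≤) x≢y with <-cmp x y
  ... | tri< x<y _ _ = inj₁ (x<y , ≤-trans y≤ (+-monoˡ-≤ q (<⇒≤ (proj₁ bx))))
  ... | tri≈ _ x≡y _ = contradiction x≡y x≢y
  ... | tri> _ _ y<x = inj₂ (y<x , ≤-trans (proj₂ bx) (+-monoˡ-≤ q (<⇒≤ b<y)))
  cons : pairCount W (x ∷ B) (x ∷ B) ≡ ℓ + D
  cons = begin
    length (filter (W x) (x ∷ B)) + pairCount W B (x ∷ B)
      ≡⟨ cong₂ _+_ (cong length (filter-reject (W x) (<-irrefl refl ∘ proj₁))) (pairCount-∷ʳ W B x B) ⟩
    length (filter (W x) B) + (length (filter (λ z → W z x) B) + D)
      ≡⟨ +-assoc (length (filter (W x) B)) (length (filter (λ z → W z x) B)) D ⟨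
    length (filter (W x) B) + length (filter (λ z → W z x) B) + D
      ≡⟨ cong (_+ D) (length-filter-+-filter (W x) (λ z → W z x)
                        (λ (x<y , _) (y<x , _) → <-asym x<y y<x) (zipWith (λ (p , q) → close p q) (bB , x∉B))) ⟩
    ℓ + D ∎

pairCount-window-blocks : ∀ q K b T → Unique T → All (Between b (b + K * q)) T →
  length T * length T ≤ K * (2 * pairCount (window? q) T T + length T)
pairCount-window-blocks q zero    b []      _  _ = z≤n
pairCount-window-blocks q zero    b (x ∷ T) _  ((b<x , x≤b+0) ∷ _) =
  contradiction (subst (x ≤_) (+-identityʳ b) x≤b+0) (<⇒≱ b<x)
pairCount-window-blocks q (suc K) b T !T T∈ = begin
  length T * length T
    ≡⟨ cong (λ ℓ → ℓ * ℓ) split-length ⟨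
  (length lo + length hi) * (length lo + length hi)
    ≤⟨ cauchy-schwarz₂ (length lo) (length hi) 1 K _ _ lo-bound hi-bound ⟩
  suc K * (2 * D lo + length lo + (2 * D hi + length hi))
    ≡⟨ cong (suc K *_) (2*a+c+[2*b+d]≡2*[a+b]+[c+d] (D lo) (D hi) (length lo) (length hi)) ⟩
  suc K * (2 * (D lo + D hi) + (length lo + length hi))
    ≤⟨ *-monoʳ-≤ (suc K) (+-mono-≤ (*-monoʳ-≤ 2 (pairCount-filter-∁ (window? q) P? T)) (≤-reflexive split-length)) ⟩
  suc K * (2 * D T + length T) ∎
  where
  open ≤-Reasoning
  D : List ℕ → ℕ
  D B = pairCount (window? q) B B
  P? = λ x → x ≤? b + q
  lo = filter P? T
  hi = filter (∁? P?) T
  split-length : length lo + length hi ≡ length T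
  split-length = trans (sym (length-++ lo)) (sym (↭-length (↭-filter-∁ P? T)))
  lo∈ : All (Between b (b + q)) lo
  lo∈ = zipWith (λ ((b<x , _) , x≤) → b<x , x≤) (All-filter⁺ P? T∈ , all-filter P? T)
  hi∈ : All (Between (b + q) (b + q + K * q)) hi
  hi∈ = zipWith (λ ((_ , x≤) , x≰) → ≰⇒> x≰ , ≤-trans x≤ (≤-reflexive (sym (+-assoc b q (K * q)))))
                (All-filter⁺ (∁? P?) T∈ , all-filter (∁? P?) T)
  lo-bound : length lo * length lo ≤ 1 * (2 * D lo + length lo)
  lo-bound = ≤-reflexive (trans (sym (pairCount-window-Between lo (Unique.filter⁺ P? !T) lo∈)) (sym (*-identityˡ _)))
  hi-bound : length hi * length hi ≤ K * (2 * D hi + length hi)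
  hi-bound = pairCount-window-blocks q K (b + q) hi (Unique.filter⁺ (∁? P?) !T) hi∈

m≤q+[m/q]*q : ∀ m q .{{_ : NonZero q}} → m ≤ q + (m / q) * q
m≤q+[m/q]*q m q = begin
  m                  ≡⟨ m≡m%n+[m/n]*n m q ⟩
  m % q + (m / q) * q  ≤⟨ +-monoˡ-≤ ((m / q) * q) (<⇒≤ (m%n<n m q)) ⟩
  q + (m / q) * q    ∎
  where open ≤-Reasoning

Δ-lower-bound : ∀ q .{{_ : NonZero q}} {m} F → Unique F → All (_≤ m) F →
  let T = filter (q <?_) F in length T * length T ≤ (m / q) * (2 * length (Δ q F) + length T)
Δ-lower-bound q {m} F !F F≤m = begin
  length T * length T
    ≤⟨ pairCount-window-blocks q (m / q) q T (Unique.filter⁺ (q <?_) !F) T∈ ⟩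
  (m / q) * (2 * pairCount (window? q) T T + length T)
    ≤⟨ *-monoʳ-≤ (m / q) (+-monoˡ-≤ (length T) (*-monoʳ-≤ 2 pairCount≤)) ⟩
  (m / q) * (2 * length (Δ q F) + length T) ∎
  where
  open ≤-Reasoning
  T = filter (q <?_) F
  T∈ : All (Between q (q + (m / q) * q)) T
  T∈ = zipWith (λ (x≤m , q<x) → q<x , ≤-trans x≤m (m≤q+[m/q]*q m q)) (All-filter⁺ (q <?_) F≤m , all-filter (q <?_) F)
  pairCount≤ : pairCount (window? q) T T ≤ length (Δ q F)
  pairCount≤ = ≤-trans (pairCount-monoʳ (window? q) T (filter-⊆ (q <?_) F))
                       (≤-reflexive (sym (length-relatedPairs (window? q) T F)))

[half/q+half/q]*q≤n : ∀ n q .{{_ : NonZero q}} → (half n / q + half n / q) * q ≤ n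
[half/q+half/q]*q≤n n q = begin
  (half n / q + half n / q) * q  ≡⟨ *-distribʳ-+ q (half n / q) (half n / q) ⟩
  half n / q * q + half n / q * q ≤⟨ +-mono-≤ (m/n*n≤m (half n) q) (m/n*n≤m (half n) q) ⟩
  half n + half n                ≡⟨ m*2≡m+m (half n) ⟨
  half n * 2                     ≤⟨ m/n*n≤m n 2 ⟩
  n                              ∎
  where open ≤-Reasoning

half<⇒∸≤half : ∀ n x → half n < x → n ∸ x ≤ half n
half<⇒∸≤half n x m<x = m≤n+o⇒m∸n≤o n x (begin
  n                       ≡⟨ m≡m%n+[m/n]*n n 2 ⟩
  n % 2 + half n * 2      ≤⟨ +-monoˡ-≤ (half n * 2) (s≤s⁻¹ (m%n<n n 2)) ⟩
  1 + half n * 2          ≡⟨ cong suc (m*2≡m+m (half n)) ⟩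
  suc (half n) + half n   ≤⟨ +-monoˡ-≤ (half n) m<x ⟩
  x + half n              ∎)
  where open ≤-Reasoning

map-∸-Unique : ∀ n {xs} → All (_≤ n) xs → Unique xs → Unique (map (n ∸_) xs)
map-∸-Unique n []            []           = []
map-∸-Unique n (x≤n ∷ xs≤n) (x∉xs ∷ !xs) =
  All-map⁺ (zipWith (λ (x≢y , y≤n) → x≢y ∘ ∸-cancelˡ-≡ x≤n y≤n) (x∉xs , xs≤n)) ∷ map-∸-Unique n xs≤n !xs

S₁-Unique : ∀ n {S} → Unique S → Unique (S₁ n S)
S₁-Unique n = Unique.filter⁺ (λ x → x ≤? half n)

S̄₂-Unique : ∀ n {S} → All (_≤ n) S → Unique S → Unique (S̄₂ n S)
S̄₂-Unique n S≤n !S = map-∸-Unique n (All-filter⁺ (λ x → half n <? x) S≤n) (Unique.filter⁺ (λ x → half n <? x) !S)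

S₁≤half : ∀ n S → All (_≤ half n) (S₁ n S)
S₁≤half n = all-filter (λ x → x ≤? half n)

S̄₂≤half : ∀ n S → All (_≤ half n) (S̄₂ n S)
S̄₂≤half n S = All-map⁺ (All.map (half<⇒∸≤half n _) (all-filter (λ x → half n <? x) S))

∈-S₁⁻ : ∀ n S {x} → x ∈ S₁ n S → x ∈ S × x ≤ half n
∈-S₁⁻ n S = ∈-filter⁻ (λ x → x ≤? half n)

∈-S̄₂⁻ : ∀ n S {x} → x ∈ S̄₂ n S → ∃ λ u → u ∈ S × half n < u × x ≡ n ∸ u
∈-S̄₂⁻ n S x∈ with ∈-map⁻ (n ∸_) x∈
... | u , u∈ , x≡n∸u = let (u∈S , m<u) = ∈-filter⁻ (λ x → half n <? x) {xs = S} u∈ in u , u∈S , m<u , x≡n∸u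

-- Taking x₃ = a and y₃ = a in the B₃ condition.
IsB3⇒summand : ∀ {S a b c d} → IsB3 S → a ∈ S → b ∈ S → c ∈ S → d ∈ S →
               a + b ≡ c + d → d ≡ a ⊎ d ≡ b
IsB3⇒summand {a = a} b3 a∈ b∈ c∈ d∈ eq with ∈-resp-↭ (↭-sym (b3 a∈ b∈ a∈ c∈ d∈ a∈ (cong (_+ a) eq))) (there (here refl))
... | here d≡a                 = inj₁ d≡a
... | there (here d≡b)         = inj₂ d≡b
... | there (there (here d≡a)) = inj₁ d≡a

Δ-S₁-S̄₂-Disjoint : ∀ n q S → All (_≤ n) S → IsB3 S → Disjoint (Δ q (S₁ n S)) (Δ q (S̄₂ n S))
Δ-S₁-S̄₂-Disjoint n q S S≤n b3 {x , y} (p∈₁ , p∈₂)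
  with ∈-relatedPairs⁻ (window? q) (filter (q <?_) (S₁ n S)) (S₁ n S) p∈₁
     | ∈-relatedPairs⁻ (window? q) (filter (q <?_) (S̄₂ n S)) (S̄₂ n S) p∈₂
... | x∈T₁ , y∈S₁ , (x<y , _) | x∈T₂ , y∈S̄₂ , _
  with ∈-S₁⁻ n S (proj₁ (∈-filter⁻ (q <?_) x∈T₁)) | ∈-S₁⁻ n S y∈S₁
     | ∈-S̄₂⁻ n S (proj₁ (∈-filter⁻ (q <?_) x∈T₂)) | ∈-S̄₂⁻ n S y∈S̄₂
... | x∈S , x≤m | y∈S , _ | u , u∈S , _ , refl | v , v∈S , m<v , refl
  with IsB3⇒summand b3 x∈S u∈S y∈S v∈S (trans (m∸n+n≡m (All.lookup S≤n u∈S)) (sym (m∸n+n≡m (All.lookup S≤n v∈S))))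
... | inj₁ v≡x = <⇒≱ m<v (subst (_≤ half n) (sym v≡x) x≤m)
... | inj₂ v≡u = <-irrefl (cong (n ∸_) (sym v≡u)) x<y

cardΔ∪≡ : ∀ n q S → Unique S → All (_≤ n) S → IsB3 S →
          cardΔ∪ n q S ≡ length (Δ q (S₁ n S)) + length (Δ q (S̄₂ n S))
cardΔ∪≡ n q S !S S≤n b3 = trans
  (cong length (deduplicate-Unique (≡-dec _≟_ _≟_) (Unique.++⁺ (Δ-Unique (S₁-Unique n !S)) (Δ-Unique (S̄₂-Unique n S≤n !S))
                                                               (Δ-S₁-S̄₂-Disjoint n q S S≤n b3))))
  (length-++ (Δ q (S₁ n S)))
  where
  Δ-Unique : ∀ {F} → Unique F → Unique (Δ q F)
  Δ-Unique !F = relatedPairs-Unique (window? q) (Unique.filter⁺ (q <?_) !F) !F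

bar-≤ : ∀ n {x} → x ≤ half n → bar n x ≡ x
bar-≤ n {x} x≤m = cong (if_then x else n ∸ x) (dec-true (x ≤? half n) x≤m)

bar-> : ∀ n {x} → ¬ x ≤ half n → bar n x ≡ n ∸ x
bar-> n {x} x≰m = cong (if_then x else n ∸ x) (dec-false (x ≤? half n) x≰m)

map-bar-↭ : ∀ n S → map (bar n) S ↭ S₁ n S ++ S̄₂ n S
map-bar-↭ n []      = ↭-refl
map-bar-↭ n (x ∷ S) with x ≤? half n
... | yes x≤m = begin
  bar n x ∷ map (bar n) S        ≡⟨ cong (_∷ map (bar n) S) (bar-≤ n x≤m) ⟩
  x ∷ map (bar n) S              ↭⟨ ↭-prep x (map-bar-↭ n S) ⟩
  x ∷ (S₁ n S ++ S̄₂ n S)         ≡⟨ cong₂ _++_ (filter-accept (λ x → x ≤? half n) x≤m)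
                                              (cong (map (n ∸_)) (filter-reject (λ x → half n <? x) (≤⇒≯ x≤m))) ⟨
  S₁ n (x ∷ S) ++ S̄₂ n (x ∷ S)   ∎
  where open PermutationReasoning
... | no x≰m = begin
  bar n x ∷ map (bar n) S        ≡⟨ cong (_∷ map (bar n) S) (bar-> n x≰m) ⟩
  (n ∸ x) ∷ map (bar n) S        ↭⟨ ↭-prep (n ∸ x) (map-bar-↭ n S) ⟩
  (n ∸ x) ∷ (S₁ n S ++ S̄₂ n S)   ↭⟨ shift (n ∸ x) (S₁ n S) (S̄₂ n S) ⟨
  S₁ n S ++ (n ∸ x) ∷ S̄₂ n S     ≡⟨ cong₂ _++_ (filter-reject (λ x → x ≤? half n) x≰m)
                                              (cong (map (n ∸_)) (filter-accept (λ x → half n <? x) (≰⇒> x≰m))) ⟨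
  S₁ n (x ∷ S) ++ S̄₂ n (x ∷ S)   ∎
  where open PermutationReasoning

length-zs : ∀ n S → length (zs n S) ≡ length S
length-zs n S = trans (↭-length (sort-↭ (map (bar n) S))) (length-map (bar n) S)

count-zs : ∀ n q S → length (filter (q <?_) (zs n S)) ≡
                     length (filter (q <?_) (S₁ n S)) + length (filter (q <?_) (S̄₂ n S))
count-zs n q S = begin
  length (filter (q <?_) (zs n S))                    ≡⟨ ↭-length (filter-↭ (q <?_) (↭-trans (sort-↭ (map (bar n) S)) (map-bar-↭ n S))) ⟩
  length (filter (q <?_) (S₁ n S ++ S̄₂ n S))          ≡⟨ cong length (filter-++ (q <?_) (S₁ n S) (S̄₂ n S)) ⟩
  length (filter (q <?_) (S₁ n S) ++ filter (q <?_) (S̄₂ n S)) ≡⟨ length-++ (filter (q <?_) (S₁ n S)) ⟩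
  length (filter (q <?_) (S₁ n S)) + length (filter (q <?_) (S̄₂ n S)) ∎
  where open ≡-Reasoning

length∸i≤count-above : ∀ {q b} L i → Linked _≤_ L → nth L i ≡ just b → q < b →
                       length L ∸ i ≤ length (filter (q <?_) L)
length∸i≤count-above {q} (x ∷ L) zero    sorted refl q<x = ≤-reflexive (sym (cong length
  (filter-all (q <?_) (All.map (<-≤-trans q<x) (Linked⇒All ≤-trans ≤-refl sorted)))))
length∸i≤count-above {q} (x ∷ L) (suc i) sorted eq   q<b = ≤-trans
  (length∸i≤count-above L i (Linked-tail sorted) eq q<b)
  (length-mono-≤ (⊆-filter⁺ (q <?_) (q <?_) (subst (q <_)) (x ∷ʳ ⊆-refl)))

folded-square-bound : ∀ n q .{{_ : NonZero q}} S → Unique S → All (_≤ n) S → IsB3 S →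
  let u = length (filter (q <?_) (S₁ n S)) + length (filter (q <?_) (S̄₂ n S)) ; K = half n / q in
  u * u ≤ (K + K) * (2 * cardΔ∪ n q S + u)
folded-square-bound n q S !S S≤n b3 = begin
  (t₁ + t₂) * (t₁ + t₂)
    ≤⟨ cauchy-schwarz₂ t₁ t₂ K K _ _ (Δ-lower-bound q (S₁ n S) (S₁-Unique n !S) (S₁≤half n S))
                                     (Δ-lower-bound q (S̄₂ n S) (S̄₂-Unique n S≤n !S) (S̄₂≤half n S)) ⟩
  (K + K) * (2 * δ₁ + t₁ + (2 * δ₂ + t₂))
    ≡⟨ cong ((K + K) *_) (2*a+c+[2*b+d]≡2*[a+b]+[c+d] δ₁ δ₂ t₁ t₂) ⟩
  (K + K) * (2 * (δ₁ + δ₂) + (t₁ + t₂))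
    ≡⟨ cong (λ c → (K + K) * (2 * c + (t₁ + t₂))) (cardΔ∪≡ n q S !S S≤n b3) ⟨
  (K + K) * (2 * cardΔ∪ n q S + (t₁ + t₂)) ∎
  where
  open ≤-Reasoning
  K = half n / q
  t₁ = length (filter (q <?_) (S₁ n S))
  t₂ = length (filter (q <?_) (S̄₂ n S))
  δ₁ = length (Δ q (S₁ n S))
  δ₂ = length (Δ q (S̄₂ n S))

lemma5 : (n : ℕ) → 1 ≤ n → (S : List ℕ) → Unique S → All (λ x → x ≤ n) S → IsB3 S →
    (q : ℕ) → 1 ≤ q → (i : ℕ) → 1 ≤ i → i < length S →
    (a b : ℕ) → nth (zs n S) (i ∸ 1) ≡ just a → nth (zs n S) i ≡ just b → a ≤ q → q < b →
    (+ (length S ∸ i)) *ℤ ((+ q) *ℤ (+ (length S ∸ i)) -ℤ (+ n))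
      ≤ℤ (+ 2) *ℤ (+ n) *ℤ (+ cardΔ∪ n q S)
lemma5 n _ S !S S≤n b3 q 1≤q i _ _ _ b _ zᵢ₊₁≡b _ q<b =
  counting-bound⇒ℤ {n} {q} (K + K) t≤u ([half/q+half/q]*q≤n n q) (folded-square-bound n q S !S S≤n b3)
  where
  instance
    q-nonZero : NonZero q
    q-nonZero = >-nonZero 1≤q
  K = half n / q
  t≤u : length S ∸ i ≤ length (filter (q <?_) (S₁ n S)) + length (filter (q <?_) (S̄₂ n S))
  t≤u = begin
    length S ∸ i                      ≡⟨ cong (_∸ i) (length-zs n S) ⟨
    length (zs n S) ∸ i               ≤⟨ length∸i≤count-above (zs n S) i (sort-↗ (map (bar n) S)) zᵢ₊₁≡b q<b ⟩
    length (filter (q <?_) (zs n S))  ≡⟨ count-zs n q S ⟩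
    length (filter (q <?_) (S₁ n S)) + length (filter (q <?_) (S̄₂ n S)) ∎
    where open ≤-Reasoning
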